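{- Let $G=(V_1\cup V_2,E)$ be a split graph with $|V_1|=|V_2|=k$ (where $V_1$ induces a complete graph and $V_2$ an edgeless graph) and with minimum degree $\delta(G)\le k/2$. Then for every nonempty $S\subseteq V_1\cup V_2$ with $|S|\le k/2$, \[ \frac{|\partial S|}{|S|}\ge\delta(G). \]
   Context: $\partial S$ denotes the set of edges of $G$ with exactly one endpoint in $S$. A split graph is a graph whose vertex set is partitioned into $V_1,V_2$ with $G[V_1]$ complete and $G[V_2]$ edgeless. -}

module Defs where

open import Data.Nat using (ℕ; _+_; _≤_)
open import Data.Bool using (Bool; true; false; T; _∧_; not)
open import Data.Fin using (Fin; _↑ˡ_; _↑ʳ_)
open import Data.Fin.Subset using (Subset; _∈_; _∉_)
open import Data.Vec using (lookup)
open import Data.List using (List; length; filter; allFin; cartesianProduct)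
open import Data.Product using (_×_; _,_; ∃)
open import Relation.Binary.PropositionalEquality using (_≡_)
open import Relation.Nullary using (¬_)
open import Relation.Nullary.Decidable using (Dec; yes; no)
open import Data.Bool using (_≟_)

record Graph (n : ℕ) : Set where
  field
    adj   : Fin n → Fin n → Bool
    sym   : ∀ u v → adj u v ≡ adj v u
    irrefl : ∀ u → adj u u ≡ false
open Graph public

Adj : ∀ {n} → Graph n → Fin n → Fin n → Set
Adj G u v = T (adj G u v)

degree : ∀ {n} → Graph n → Fin n → ℕ
degree G u = length (filter (λ v → adj G u v ≟ true) (allFin _))

IsMinDegree : ∀ {n} → Graph n → ℕ → Set
IsMinDegree G d = (∃ λ v → degree G v ≡ d) × (∀ v → d ≤ degree G v)

-- Vertex set Fin (k + k): V₁ = {i ↑ˡ k}, V₂ = {k ↑ʳ i}.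
-- G is split with respect to this partition: V₁ a clique, V₂ independent.
IsSplit : (k : ℕ) → Graph (k + k) → Set
IsSplit k G =
  (∀ (i j : Fin k) → ¬ (i ≡ j) → Adj G (i ↑ˡ k) (j ↑ˡ k)) ×
  (∀ (i j : Fin k) → ¬ (Adj G (k ↑ʳ i) (k ↑ʳ j)))

-- |∂S|: each edge with exactly one endpoint in S is counted once, as the
-- ordered pair (u , v) with u ∈ S, v ∉ S.
boundarySize : ∀ {n} → Graph n → Subset n → ℕ
boundarySize {n} G S =
  length (filter (λ p → (lookup S (Data.Product.proj₁ p) ∧ not (lookup S (Data.Product.proj₂ p))
                          ∧ adj G (Data.Product.proj₁ p) (Data.Product.proj₂ p)) ≟ true)
                 (cartesianProduct (allFin n) (allFin n)))

-- Split S into its clique part S₁ (a vertices) and independent part S₂ (b vertices).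
-- A vertex of S₁ is adjacent to the k − a clique vertices outside S, and a vertex of S₂
-- has at most a neighbours inside S (all in S₁), hence at least δ − a outside S.
-- So |∂S| ≥ a(k − a) + b(δ − a), which is at least δ(a + b) once a + b ≤ k/2 and δ ≤ k/2:
-- if δ ≤ a use a + b ≤ k − a, otherwise δ(a + b) = a(δ + b) + b(δ − a) with δ + b ≤ k − a.
module Submission where

open import Defs hiding (sym)
open import Data.Nat using (ℕ; zero; suc; _+_; _*_; _∸_; _≤_; _<_; z≤n)
open import Data.Nat.Properties hiding (_≟_)
open import Data.Nat.Tactic.RingSolver using (solve-∀)
open import Data.Bool using (Bool; true; false; _∧_; not; _≟_)
open import Data.Bool.Properties using (T-≡; ∧-identityʳ; ∧-zeroʳ)
open import Function.Bundles using (Equivalence)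
open import Data.Fin using (Fin; _↑ˡ_; _↑ʳ_) renaming (zero to fzero; suc to fsuc)
import Data.Fin as Fin
open import Data.Fin.Subset using (Subset; ∣_∣)
open import Data.Vec using (lookup; []; _∷_)
open import Data.List using (List; length; filter; tabulate; cartesianProduct; map; _++_)
open import Data.List.Properties using (length-++; filter-++; map-tabulate)
open import Data.Product using (_,_; _×_; proj₁; proj₂)
open import Data.Sum using (inj₁; inj₂)
open import Function using (_∘_)
open import Relation.Nullary using (yes; no; contradiction)
open import Relation.Binary.PropositionalEquality
open import Algebra.Properties.Semiring.Sum +-*-semiring
  using (sum-syntax; sum-cong-≗; sum-replicate-zero; ∑-distrib-+; *-distribʳ-sum)

𝟙 : Bool → ℕ
𝟙 true  = 1
𝟙 false = 0

private variable
  A : Set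
  m n : ℕ

∑-mono-≤ : {f g : Fin n → ℕ} → (∀ i → f i ≤ g i) → ∑[ i < n ] f i ≤ ∑[ i < n ] g i
∑-mono-≤ {zero}  f≤g = z≤n
∑-mono-≤ {suc n} f≤g = +-mono-≤ (f≤g fzero) (∑-mono-≤ (f≤g ∘ fsuc))

∑-split : (f : Fin (m + n) → ℕ) →
          ∑[ i < m + n ] f i ≡ ∑[ i < m ] f (i ↑ˡ n) + ∑[ j < n ] f (m ↑ʳ j)
∑-split {zero}  f = refl
∑-split {suc m} f = trans (cong (f fzero +_) (∑-split {m} (f ∘ fsuc))) (sym (+-assoc (f fzero) _ _))

∑-const-1 : ∀ n → ∑[ i < n ] 1 ≡ n
∑-const-1 zero    = refl
∑-const-1 (suc n) = cong suc (∑-const-1 n)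

∑-𝟙-not+∑-𝟙 : (p : Fin n → Bool) → ∑[ i < n ] 𝟙 (not (p i)) + ∑[ i < n ] 𝟙 (p i) ≡ n
∑-𝟙-not+∑-𝟙 {n} p = trans (sym (∑-distrib-+ (𝟙 ∘ not ∘ p) (𝟙 ∘ p)))
  (trans (sum-cong-≗ (complement ∘ p)) (∑-const-1 n))
  where
  complement : ∀ b → 𝟙 (not b) + 𝟙 b ≡ 1
  complement true  = refl
  complement false = refl

∑-𝟙-not : (p : Fin n → Bool) → ∑[ i < n ] 𝟙 (not (p i)) ≡ n ∸ ∑[ i < n ] 𝟙 (p i)
∑-𝟙-not {n} p = trans (sym (m+n∸n≡m _ (∑[ i < n ] 𝟙 (p i)))) (cong (_∸ ∑[ i < n ] 𝟙 (p i)) (∑-𝟙-not+∑-𝟙 p))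

module _ (p : A → Bool) where

  private
    count : List A → ℕ
    count xs = length (filter (λ x → p x ≟ true) xs)

  length-filter-tabulate : (f : Fin n → A) → count (tabulate f) ≡ ∑[ i < n ] 𝟙 (p (f i))
  length-filter-tabulate {zero}  f = refl
  length-filter-tabulate {suc n} f with p (f fzero)
  ... | true  = cong suc (length-filter-tabulate (f ∘ fsuc))
  ... | false = length-filter-tabulate (f ∘ fsuc)

  length-filter-++ : (xs ys : List A) → count (xs ++ ys) ≡ count xs + count ys
  length-filter-++ xs ys = trans (cong length (filter-++ _ xs ys)) (length-++ (filter _ xs))

module _ {B : Set} (p : A × B → Bool) where

  length-filter-cartesianProduct :
    (f : Fin m → A) (g : Fin n → B) →
    length (filter (λ q → p q ≟ true) (cartesianProduct (tabulate f) (tabulate g)))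
      ≡ ∑[ i < m ] ∑[ j < n ] 𝟙 (p (f i , g j))
  length-filter-cartesianProduct {zero}  f g = refl
  length-filter-cartesianProduct {suc m} f g = begin
    length (filter _ (map (f fzero ,_) (tabulate g) ++ cartesianProduct (tabulate (f ∘ fsuc)) (tabulate g)))
      ≡⟨ length-filter-++ p (map (f fzero ,_) (tabulate g)) _ ⟩
    length (filter _ (map (f fzero ,_) (tabulate g))) + length (filter _ (cartesianProduct (tabulate (f ∘ fsuc)) (tabulate g)))
      ≡⟨ cong₂ _+_ (trans (cong (length ∘ filter _) (map-tabulate g (f fzero ,_)))
                          (length-filter-tabulate p (λ j → f fzero , g j)))
                   (length-filter-cartesianProduct (f ∘ fsuc) g) ⟩
    ∑[ j < _ ] 𝟙 (p (f fzero , g j)) + ∑[ i < m ] ∑[ j < _ ] 𝟙 (p (f (fsuc i) , g j))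
      ∎
    where open ≡-Reasoning

∣p∣≡∑ : (p : Subset n) → ∣ p ∣ ≡ ∑[ i < n ] 𝟙 (lookup p i)
∣p∣≡∑ []          = refl
∣p∣≡∑ (true ∷ p)  = cong suc (∣p∣≡∑ p)
∣p∣≡∑ (false ∷ p) = ∣p∣≡∑ p

𝟙-∧-≤ˡ : ∀ x y → 𝟙 (x ∧ y) ≤ 𝟙 x
𝟙-∧-≤ˡ true  true  = ≤-refl
𝟙-∧-≤ˡ true  false = z≤n
𝟙-∧-≤ˡ false y     = z≤n

𝟙-*-monoʳ-≤ : ∀ b {x y} → (b ≡ true → x ≤ y) → 𝟙 b * x ≤ 𝟙 b * y
𝟙-*-monoʳ-≤ true  x≤y = *-monoʳ-≤ 1 (x≤y refl)
𝟙-*-monoʳ-≤ false x≤y = z≤n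

module _ (G : Graph n) (S : Subset n) where

  degreeOutside degreeInside : Fin n → ℕ
  degreeOutside u = ∑[ v < n ] 𝟙 (not (lookup S v) ∧ adj G u v)
  degreeInside  u = ∑[ v < n ] 𝟙 (lookup S v ∧ adj G u v)

  degree≡degreeOutside+degreeInside : ∀ u → degree G u ≡ degreeOutside u + degreeInside u
  degree≡degreeOutside+degreeInside u =
    trans (length-filter-tabulate (adj G u) (λ v → v))
      (trans (sum-cong-≗ {n} (λ v → partition (lookup S v) (adj G u v))) (∑-distrib-+ {n} _ _))
    where
    partition : ∀ s e → 𝟙 e ≡ 𝟙 (not s ∧ e) + 𝟙 (s ∧ e)
    partition true  e = refl
    partition false e = sym (+-identityʳ (𝟙 e))

  boundarySize≡∑-degreeOutside : boundarySize G S ≡ ∑[ u < n ] (𝟙 (lookup S u) * degreeOutside u)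
  boundarySize≡∑-degreeOutside =
    trans (length-filter-cartesianProduct _ {n} {n} (λ u → u) (λ v → v)) (sum-cong-≗ {n} edgesLeaving)
    where
    edgesLeaving : ∀ u → ∑[ v < n ] 𝟙 (lookup S u ∧ not (lookup S v) ∧ adj G u v)
                           ≡ 𝟙 (lookup S u) * degreeOutside u
    edgesLeaving u with lookup S u
    ... | true  = sym (+-identityʳ (degreeOutside u))
    ... | false = sum-replicate-zero n

+-≤-of-doubles : ∀ x y {k} → 2 * x ≤ k → 2 * y ≤ k → x + y ≤ k
+-≤-of-doubles x y {k} 2x≤k 2y≤k =
  *-cancelˡ-≤ 2 (≤-trans (≤-reflexive (*-distribˡ-+ 2 x y)) (≤-trans (+-mono-≤ 2x≤k 2y≤k) (≤-reflexive double)))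
  where
  double : k + k ≡ 2 * k
  double = cong (k +_) (sym (+-identityʳ k))

δ[a+b]≤a[k∸a]+b[δ∸a] : ∀ k δ a b → (a + b) + a ≤ k → (δ + b) + a ≤ k →
                        δ * (a + b) ≤ a * (k ∸ a) + b * (δ ∸ a)
δ[a+b]≤a[k∸a]+b[δ∸a] k δ a b small-S small-δ with ≤-total δ a
... | inj₁ δ≤a = begin
  δ * (a + b)                       ≤⟨ *-monoˡ-≤ (a + b) δ≤a ⟩
  a * (a + b)                       ≤⟨ *-monoʳ-≤ a (m+n≤o⇒m≤o∸n (a + b) small-S) ⟩
  a * (k ∸ a)                       ≤⟨ m≤m+n (a * (k ∸ a)) (b * (δ ∸ a)) ⟩
  a * (k ∸ a) + b * (δ ∸ a)         ∎
  where open ≤-Reasoning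
... | inj₂ a≤δ = begin
  δ * (a + b)                       ≡⟨ cong (_* (a + b)) δ≡a+d ⟨
  (a + d) * (a + b)                 ≡⟨ regroup a d b ⟩
  a * ((a + d) + b) + b * d         ≡⟨ cong (λ x → a * (x + b) + b * d) δ≡a+d ⟩
  a * (δ + b) + b * d               ≤⟨ +-monoˡ-≤ (b * d) (*-monoʳ-≤ a (m+n≤o⇒m≤o∸n (δ + b) small-δ)) ⟩
  a * (k ∸ a) + b * d               ∎
  where
  open ≤-Reasoning
  d = δ ∸ a
  δ≡a+d : a + d ≡ δ
  δ≡a+d = m+[n∸m]≡n a≤δ
  regroup : ∀ a d b → (a + d) * (a + b) ≡ a * ((a + d) + b) + b * d
  regroup = solve-∀

module _ (k : ℕ) (G : Graph (k + k)) (S : Subset (k + k)) where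

  private
    S₁ S₂ : Fin k → Bool
    S₁ i = lookup S (i ↑ˡ k)
    S₂ i = lookup S (k ↑ʳ i)

  ∣S₁∣ ∣S₂∣ : ℕ
  ∣S₁∣ = ∑[ i < k ] 𝟙 (S₁ i)
  ∣S₂∣ = ∑[ i < k ] 𝟙 (S₂ i)

  ∣S∣≡∣S₁∣+∣S₂∣ : ∣ S ∣ ≡ ∣S₁∣ + ∣S₂∣
  ∣S∣≡∣S₁∣+∣S₂∣ = trans (∣p∣≡∑ S) (∑-split {k} (𝟙 ∘ lookup S))

  module _ (split : IsSplit k G) where

    clique-degreeOutside-≥ : ∀ i → S₁ i ≡ true → k ∸ ∣S₁∣ ≤ degreeOutside G S (i ↑ˡ k)
    clique-degreeOutside-≥ i i∈S = begin
      k ∸ ∣S₁∣                                                     ≡⟨ ∑-𝟙-not S₁ ⟨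
      ∑[ j < k ] 𝟙 (not (S₁ j))                                    ≤⟨ ∑-mono-≤ {k} adjacent-if-outside ⟩
      ∑[ j < k ] 𝟙 (not (S₁ j) ∧ adj G (i ↑ˡ k) (j ↑ˡ k))           ≤⟨ m≤m+n _ _ ⟩
      ∑[ j < k ] 𝟙 (not (S₁ j) ∧ adj G (i ↑ˡ k) (j ↑ˡ k))
        + ∑[ j < k ] 𝟙 (not (S₂ j) ∧ adj G (i ↑ˡ k) (k ↑ʳ j))      ≡⟨ ∑-split {k} _ ⟨
      degreeOutside G S (i ↑ˡ k)                                   ∎
      where
      open ≤-Reasoning
      adjacent-if-outside : ∀ j → 𝟙 (not (S₁ j)) ≤ 𝟙 (not (S₁ j) ∧ adj G (i ↑ˡ k) (j ↑ˡ k))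
      adjacent-if-outside j with i Fin.≟ j
      ... | yes refl rewrite i∈S = z≤n
      ... | no i≢j rewrite Equivalence.to T-≡ (proj₁ split i j i≢j) =
        ≤-reflexive (cong 𝟙 (sym (∧-identityʳ (not (S₁ j)))))

    independent-degreeInside-≤ : ∀ i → degreeInside G S (k ↑ʳ i) ≤ ∣S₁∣
    independent-degreeInside-≤ i = begin
      degreeInside G S (k ↑ʳ i)                                    ≡⟨ ∑-split {k} _ ⟩
      ∑[ j < k ] 𝟙 (S₁ j ∧ adj G (k ↑ʳ i) (j ↑ˡ k))
        + ∑[ j < k ] 𝟙 (S₂ j ∧ adj G (k ↑ʳ i) (k ↑ʳ j))            ≤⟨ +-mono-≤ (∑-mono-≤ {k} (λ j → 𝟙-∧-≤ˡ (S₁ j) _))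
                                                                              (≤-reflexive (trans (sum-cong-≗ {k} no-edge) (sum-replicate-zero k))) ⟩
      ∣S₁∣ + 0                                                     ≡⟨ +-identityʳ ∣S₁∣ ⟩
      ∣S₁∣                                                         ∎
      where
      open ≤-Reasoning
      no-edge : ∀ j → 𝟙 (S₂ j ∧ adj G (k ↑ʳ i) (k ↑ʳ j)) ≡ 0
      no-edge j with adj G (k ↑ʳ i) (k ↑ʳ j) in e
      ... | true  = contradiction (Equivalence.from T-≡ e) (proj₂ split i j)
      ... | false = cong 𝟙 (∧-zeroʳ (S₂ j))

    independent-degreeOutside-≥ : ∀ {δ} → (∀ v → δ ≤ degree G v) →
                                  ∀ i → δ ∸ ∣S₁∣ ≤ degreeOutside G S (k ↑ʳ i)
    independent-degreeOutside-≥ {δ} δ≤deg i = m≤n+o⇒m∸n≤o δ ∣S₁∣ (begin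
      δ                                                            ≤⟨ δ≤deg (k ↑ʳ i) ⟩
      degree G (k ↑ʳ i)                                            ≡⟨ degree≡degreeOutside+degreeInside G S (k ↑ʳ i) ⟩
      degreeOutside G S (k ↑ʳ i) + degreeInside G S (k ↑ʳ i)       ≤⟨ +-monoʳ-≤ _ (independent-degreeInside-≤ i) ⟩
      degreeOutside G S (k ↑ʳ i) + ∣S₁∣                            ≡⟨ +-comm _ ∣S₁∣ ⟩
      ∣S₁∣ + degreeOutside G S (k ↑ʳ i)                            ∎)
      where open ≤-Reasoning

    boundarySize-≥ : ∀ {δ} → (∀ v → δ ≤ degree G v) →
                     ∣S₁∣ * (k ∸ ∣S₁∣) + ∣S₂∣ * (δ ∸ ∣S₁∣) ≤ boundarySize G S
    boundarySize-≥ {δ} δ≤deg = begin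
      ∣S₁∣ * (k ∸ ∣S₁∣) + ∣S₂∣ * (δ ∸ ∣S₁∣)
        ≡⟨ cong₂ _+_ (*-distribʳ-sum (k ∸ ∣S₁∣) (𝟙 ∘ S₁)) (*-distribʳ-sum (δ ∸ ∣S₁∣) (𝟙 ∘ S₂)) ⟩
      ∑[ i < k ] (𝟙 (S₁ i) * (k ∸ ∣S₁∣)) + ∑[ i < k ] (𝟙 (S₂ i) * (δ ∸ ∣S₁∣))
        ≤⟨ +-mono-≤ (∑-mono-≤ {k} (λ i → 𝟙-*-monoʳ-≤ (S₁ i) (clique-degreeOutside-≥ i)))
                    (∑-mono-≤ {k} (λ i → 𝟙-*-monoʳ-≤ (S₂ i) (λ _ → independent-degreeOutside-≥ δ≤deg i))) ⟩
      ∑[ i < k ] (𝟙 (S₁ i) * degreeOutside G S (i ↑ˡ k)) + ∑[ i < k ] (𝟙 (S₂ i) * degreeOutside G S (k ↑ʳ i))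
        ≡⟨ trans (boundarySize≡∑-degreeOutside G S) (∑-split {k} _) ⟨
      boundarySize G S
        ∎
      where open ≤-Reasoning

lemma7p2 : (k : ℕ) (G : Graph (k + k)) (δ : ℕ) →
    IsSplit k G → IsMinDegree G δ → 2 * δ ≤ k →
    (S : Subset (k + k)) → 0 < ∣ S ∣ → 2 * ∣ S ∣ ≤ k →
    δ * ∣ S ∣ ≤ boundarySize G S
lemma7p2 k G δ split (_ , δ≤deg) 2δ≤k S _ 2∣S∣≤k = begin
  δ * ∣ S ∣                 ≡⟨ cong (δ *_) (∣S∣≡∣S₁∣+∣S₂∣ k G S) ⟩
  δ * (a + b)               ≤⟨ δ[a+b]≤a[k∸a]+b[δ∸a] k δ a b small-S small-δ ⟩
  a * (k ∸ a) + b * (δ ∸ a) ≤⟨ boundarySize-≥ k G S split δ≤deg ⟩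
  boundarySize G S          ∎
  where
  open ≤-Reasoning
  a = ∣S₁∣ k G S
  b = ∣S₂∣ k G S
  2[a+b]≤k : 2 * (a + b) ≤ k
  2[a+b]≤k = subst (λ s → 2 * s ≤ k) (∣S∣≡∣S₁∣+∣S₂∣ k G S) 2∣S∣≤k
  small-S : (a + b) + a ≤ k
  small-S = +-≤-of-doubles (a + b) a 2[a+b]≤k (≤-trans (*-monoʳ-≤ 2 (m≤m+n a b)) 2[a+b]≤k)
  small-δ : (δ + b) + a ≤ k
  small-δ = ≤-trans (≤-reflexive (+-assoc δ b a)) (+-≤-of-doubles δ (b + a) 2δ≤k (subst (λ s → 2 * s ≤ k) (+-comm a b) 2[a+b]≤k))
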